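{- For positive integers $a,b$, there exists a graph $G$ with $\chi_{\mathrm{gp}}(G)=a$ and clique cover number $\theta(G)=b$ if and only if $a=b=1$ or $2\le a\le b$.
   Context: A set $S$ is in general position if no shortest path of the graph contains more than two vertices of $S$; $\chi_{\mathrm{gp}}(G)$ is the minimum number of colours in a colouring of $V(G)$ with each colour class in general position. $\theta(G)$ is the minimum number of cliques partitioning $V(G)$. -}

module Defs where

open import Data.Nat using (ℕ; suc; _≤_; _<_)
open import Data.Fin using (Fin; inject₁; fromℕ; toℕ) renaming (zero to fzero; suc to fsuc)
open import Data.Product using (Σ; ∃; _×_; _,_)
open import Relation.Binary.PropositionalEquality using (_≡_; _≢_)
open import Relation.Nullary using (¬_)

record Graph (n : ℕ) : Set₁ where
  field
    Adj   : Fin n → Fin n → Set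
    sym   : ∀ {u v} → Adj u v → Adj v u
    irrefl : ∀ {u} → ¬ Adj u u
open Graph public

IsWalk : ∀ {n} → Graph n → (k : ℕ) → (Fin (suc k) → Fin n) → Set
IsWalk G k p = ∀ (i : Fin k) → Adj G (p (inject₁ i)) (p (fsuc i))

WalkFromTo : ∀ {n} → Graph n → Fin n → Fin n → (k : ℕ) → (Fin (suc k) → Fin n) → Set
WalkFromTo G u v k p = IsWalk G k p × p fzero ≡ u × p (fromℕ k) ≡ v

Connected : ∀ {n} → Graph n → Set
Connected {n} G = ∀ (u v : Fin n) → Σ ℕ λ k → Σ (Fin (suc k) → Fin n) λ p → WalkFromTo G u v k p

IsShortestPath : ∀ {n} → Graph n → (k : ℕ) → (Fin (suc k) → Fin n) → Set
IsShortestPath {n} G k p =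
  IsWalk G k p ×
  (∀ (m : ℕ) (q : Fin (suc m) → Fin n) → WalkFromTo G (p fzero) (p (fromℕ k)) m q → k ≤ m)

-- S is in general position: no shortest path contains more than two
-- vertices of S (vertices of a shortest path are distinct, so this means
-- no three positions i < j < l on it carry vertices of S).
GeneralPosition : ∀ {n} → Graph n → (Fin n → Set) → Set
GeneralPosition {n} G S =
  ∀ (k : ℕ) (p : Fin (suc k) → Fin n) → IsShortestPath G k p →
  ∀ (i j l : Fin (suc k)) → toℕ i < toℕ j → toℕ j < toℕ l →
  ¬ (S (p i) × S (p j) × S (p l))

IsGpColouring : ∀ {n} → Graph n → (a : ℕ) → (Fin n → Fin a) → Set
IsGpColouring G a c = ∀ (x : Fin a) → GeneralPosition G (λ v → c v ≡ x)

IsChiGp : ∀ {n} → Graph n → ℕ → Set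
IsChiGp {n} G a =
  (Σ (Fin n → Fin a) λ c → IsGpColouring G a c) ×
  (∀ (k : ℕ) (c : Fin n → Fin k) → IsGpColouring G k c → a ≤ k)

IsClique : ∀ {n} → Graph n → (Fin n → Set) → Set
IsClique G S = ∀ u v → S u → S v → u ≢ v → Adj G u v

IsCliqueCover : ∀ {n} → Graph n → (b : ℕ) → (Fin n → Fin b) → Set
IsCliqueCover G b c = ∀ (x : Fin b) → IsClique G (λ v → c v ≡ x)

IsTheta : ∀ {n} → Graph n → ℕ → Set
IsTheta {n} G b =
  (Σ (Fin n → Fin b) λ c → IsCliqueCover G b c) ×
  (∀ (k : ℕ) (c : Fin n → Fin k) → IsCliqueCover G k c → b ≤ k)

-- A clique, and likewise a set of vertices of degree at most one, meets every shortest
-- path in at most two vertices (otherwise the path could be shortcut), so a clique cover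
-- is a gp-colouring and χ_gp ≤ θ.  If one colour suffices, no shortest path has two
-- edges, so a connected graph is complete and θ = 1.
--
-- Conversely K₁ realises (1, 1).  For 2 ≤ a ≤ b take a path on 2a − 1 vertices with
-- b − a leaves attached to its second vertex.  Its first vertex together with the leaves,
-- and the a − 1 pairs of consecutive path vertices that remain, form a gp-colouring; the
-- whole path is shortest and each colour occurs on it at most twice, so χ_gp = a.
-- The pairs {0,1}, {2,3}, …, the last path vertex and the leaves form a cover by b
-- cliques, and the a even path vertices together with the leaves are independent, so θ = b.

module Submission where

open import Defs
open import Data.Empty using (⊥; ⊥-elim)
open import Data.Fin as Fin using (Fin; toℕ; fromℕ; fromℕ<; inject₁; lower₁; combine)
  renaming (zero to fzero; suc to fsuc)
import Data.Fin.Properties as Fin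
open import Data.Nat using (ℕ; zero; suc; _+_; _*_; _∸_; _≤_; _<_; z≤n; s≤s; _≤?_; _<?_; ⌊_/2⌋; ⌈_/2⌉)
open import Data.Nat.Induction using (<-rec)
open import Data.Nat.Properties
open import Data.Product using (Σ; ∃; _×_; _,_; proj₁; proj₂)
open import Data.Sum using (_⊎_; inj₁; inj₂; [_,_]; swap)
open import Function using (_∘_)
open import Function.Bundles using (_⇔_; mk⇔)
open import Relation.Binary.Definitions using (tri<; tri≈; tri>)
open import Relation.Binary.PropositionalEquality as ≡ using (_≡_; _≢_; refl; trans; cong; subst; subst₂)
open import Relation.Nullary using (¬_; Dec; yes; no)
open import Relation.Nullary.Decidable using (decidable-stable; _×-dec_)
open import Relation.Nullary.Negation using (¬¬-map)

private
  variable
    n k l d : ℕ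
    G : Graph n
    u v w : Fin n

data Walk (G : Graph n) : Fin n → Fin n → ℕ → Set where
  []  : Walk G u u 0
  _∷_ : Adj G u v → Walk G v w k → Walk G u w (suc k)

infixr 5 _∷_ _++ʷ_
infixl 5 _∷ʳ_

_++ʷ_ : Walk G u v k → Walk G v w l → Walk G u w (k + l)
[]      ++ʷ q = q
(a ∷ p) ++ʷ q = a ∷ (p ++ʷ q)

_∷ʳ_ : Walk G u v k → Adj G v w → Walk G u w (suc k)
[]      ∷ʳ a = a ∷ []
(b ∷ p) ∷ʳ a = b ∷ (p ∷ʳ a)

reverseʷ : Walk G u v k → Walk G v u k
reverseʷ         []      = []
reverseʷ {G = G} (a ∷ p) = reverseʷ p ∷ʳ Graph.sym G a

walk-≤1 : Walk G u v k → k ≤ 1 → u ≡ v ⊎ Adj G u v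
walk-≤1 []           _        = inj₁ refl
walk-≤1 (a ∷ [])     _        = inj₂ a
walk-≤1 (_ ∷ _ ∷ _) (s≤s ())

vertices : Walk G u v k → Fin (suc k) → Fin _
vertices {u = u} _       fzero    = u
vertices         []      (fsuc ())
vertices         (_ ∷ p) (fsuc i) = vertices p i

vertices-isWalk : (p : Walk G u v k) → IsWalk G k (vertices p)
vertices-isWalk (a ∷ p) fzero    = a
vertices-isWalk (_ ∷ p) (fsuc i) = vertices-isWalk p i

vertices-last : (p : Walk G u v k) → vertices p (fromℕ k) ≡ v
vertices-last []      = refl
vertices-last (_ ∷ p) = vertices-last p

walk⇒walkFromTo : (p : Walk G u v k) → WalkFromTo G u v k (vertices p)
walk⇒walkFromTo p = vertices-isWalk p , refl , vertices-last p

isWalk⇒walk : ∀ {p} → IsWalk G k p → Walk G (p fzero) (p (fromℕ k)) k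
isWalk⇒walk {k = zero}  w = []
isWalk⇒walk {k = suc k} {p} w = w fzero ∷ isWalk⇒walk {p = p ∘ fsuc} (w ∘ fsuc)

walkFromTo⇒walk : ∀ {p} → WalkFromTo G u v k p → Walk G u v k
walkFromTo⇒walk {p = p} (w , refl , refl) = isWalk⇒walk {p = p} w

prefix : ∀ {p} → IsWalk G k p → (i : Fin (suc k)) → Walk G (p fzero) (p i) (toℕ i)
prefix             w fzero    = []
prefix {k = suc k} {p} w (fsuc i) = w fzero ∷ prefix {p = p ∘ fsuc} (w ∘ fsuc) i

suffix : ∀ {p} → IsWalk G k p → (i : Fin (suc k)) → Walk G (p i) (p (fromℕ k)) (k ∸ toℕ i)
suffix {p = p}     w fzero    = isWalk⇒walk {p = p} w
suffix {k = suc k} {p} w (fsuc i) = suffix {p = p ∘ fsuc} (w ∘ fsuc) i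

connected⇒walk : Connected G → ∀ u v → ∃ (Walk G u v)
connected⇒walk conn u v with conn u v
... | k , p , fromTo = k , walkFromTo⇒walk {p = p} fromTo

reachable⇒connected : (r : Fin n) → (∀ v → ∃ (Walk G r v)) → Connected G
reachable⇒connected r reach u v with reach u | reach v
... | k , p | l , q = k + l , vertices (reverseʷ p ++ʷ q) , walk⇒walkFromTo (reverseʷ p ++ʷ q)

walk-potential : (φ : Fin n → ℕ) → (∀ {x y} → Adj G x y → φ y ≤ suc (φ x)) →
  Walk G u v k → φ v ≤ k + φ u
walk-potential         φ step []      = ≤-refl
walk-potential {u = u} {k = suc k} φ step (a ∷ p) =
  ≤-trans (walk-potential φ step p) (≤-trans (+-monoʳ-≤ k (step a)) (≤-reflexive (+-suc k (φ u))))

shortestPath-minimal : ∀ {m} p → IsShortestPath G k p → Walk G (p fzero) (p (fromℕ k)) m → k ≤ m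
shortestPath-minimal p (_ , minimal) q = minimal _ (vertices q) (walk⇒walkFromTo q)

minimal⇒shortestPath : (p : Walk G u v k) → (∀ {m} → Walk G u v m → k ≤ m) →
  IsShortestPath G k (vertices p)
minimal⇒shortestPath {G = G} p minimal = vertices-isWalk p , λ m q fromTo →
  minimal (subst (λ x → Walk G _ x m) (vertices-last p) (walkFromTo⇒walk {p = q} fromTo))

shortestPath-segment : ∀ p → IsShortestPath G k p → (i j : Fin (suc k)) →
  Walk G (p i) (p j) d → toℕ j ≤ d + toℕ i
shortestPath-segment {G = G} {k = k} {d = d} p sp i j q =
  +-cancelʳ-≤ (k ∸ toℕ j) (toℕ j) (d + toℕ i) (begin
    toℕ j + (k ∸ toℕ j)       ≡⟨ m+[n∸m]≡n (Fin.toℕ≤pred[n] j) ⟩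
    k                         ≤⟨ shortestPath-minimal p sp spliced ⟩
    toℕ i + (d + (k ∸ toℕ j)) ≡⟨ ≡.sym (+-assoc (toℕ i) d _) ⟩
    toℕ i + d + (k ∸ toℕ j)   ≡⟨ cong (_+ (k ∸ toℕ j)) (+-comm (toℕ i) d) ⟩
    d + toℕ i + (k ∸ toℕ j)   ∎)
  where
  open ≤-Reasoning
  spliced : Walk G (p fzero) (p (fromℕ k)) (toℕ i + (d + (k ∸ toℕ j)))
  spliced = prefix {p = p} (proj₁ sp) i ++ʷ q ++ʷ suffix {p = p} (proj₁ sp) j

shortestPath-noBacktrack : ∀ p → IsShortestPath G k p → (s t : Fin k) →
  inject₁ t ≡ fsuc s → p (inject₁ s) ≢ p (fsuc t)
shortestPath-noBacktrack {G = G} p sp s t t≡s+1 ps≡pt+1 = 1+n≰n (begin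
  suc (toℕ s)         ≤⟨ n≤1+n _ ⟩
  suc (suc (toℕ s))   ≡⟨ cong suc toℕ-t ⟨
  toℕ (fsuc t)        ≤⟨ shortestPath-segment p sp (inject₁ s) (fsuc t)
                           (subst (λ x → Walk G (p (inject₁ s)) x 0) ps≡pt+1 []) ⟩
  toℕ (inject₁ s)     ≡⟨ Fin.toℕ-inject₁ s ⟩
  toℕ s               ∎)
  where
  open ≤-Reasoning
  toℕ-t : toℕ t ≡ suc (toℕ s)
  toℕ-t = trans (≡.sym (Fin.toℕ-inject₁ t)) (cong toℕ t≡s+1)

DegreeAtMostOne : Graph n → Fin n → Set
DegreeAtMostOne G v = ∀ {x y} → Adj G v x → Adj G v y → x ≡ y

shortestPath-interior : ∀ p → IsShortestPath G k p → (j : Fin (suc k)) →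
  0 < toℕ j → toℕ j < k → ¬ DegreeAtMostOne G (p j)
shortestPath-interior {G = G} {k = k} p sp (fsuc s) _ j<k degree =
  shortestPath-noBacktrack {G = G} p sp s t t≡s+1
    (degree (Graph.sym G (proj₁ sp s)) (subst (λ x → Adj G (p x) (p (fsuc t))) t≡s+1 (proj₁ sp t)))
  where
  k≢j : k ≢ toℕ (fsuc s)
  k≢j = <⇒≢ j<k ∘ ≡.sym
  t : Fin k
  t = lower₁ (fsuc s) k≢j
  t≡s+1 : inject₁ t ≡ fsuc s
  t≡s+1 = Fin.inject₁-lower₁ (fsuc s) k≢j

clique⇒generalPosition : ∀ {S} → IsClique G S → GeneralPosition G S
clique⇒generalPosition {G = G} clique k p sp i j l i<j j<l (Si , _ , Sl) with p i Fin.≟ p l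
... | yes pi≡pl = <⇒≱ (<-trans i<j j<l)
        (shortestPath-segment {G = G} p sp i l (subst (λ x → Walk G (p i) x 0) pi≡pl []))
... | no pi≢pl  = <⇒≱ (≤-trans (s≤s i<j) j<l)
        (shortestPath-segment {G = G} p sp i l (clique (p i) (p l) Si Sl pi≢pl ∷ []))

degreeAtMostOne⇒generalPosition : ∀ {S} → (∀ {v} → S v → DegreeAtMostOne G v) → GeneralPosition G S
degreeAtMostOne⇒generalPosition {G = G} pendant k p sp i j l i<j j<l (_ , Sj , _) =
  shortestPath-interior {G = G} p sp j (≤-trans (s≤s z≤n) i<j) (<-≤-trans j<l (Fin.toℕ≤pred[n] l)) (pendant Sj)

-- Tagging each point with whether its value occurred earlier makes f injective into Fin K × Fin 2.
fibresAtMostTwo⇒≤ : ∀ {N K} (f : Fin N → Fin K) →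
  (∀ {i j l} → i Fin.< j → j Fin.< l → f i ≡ f j → f j ≡ f l → ⊥) → N ≤ K * 2
fibresAtMostTwo⇒≤ {N} {K} f noTriple = decidable-stable (N ≤? K * 2) λ N≰2K →
  let i , j , i<j , gi≡gj = Fin.pigeonhole (≰⇒> N≰2K) tagged
      fi≡fj , tagi≡tagj = Fin.combine-injective (f i) _ (f j) _ gi≡gj
  in  distinctTags i<j fi≡fj tagi≡tagj
  where
  repeated? : ∀ j → Dec (∃ λ i → i Fin.< j × f i ≡ f j)
  repeated? j = Fin.any? λ i → (i Fin.<? j) ×-dec (f i Fin.≟ f j)
  tag : ∀ {A : Set} → Dec A → Fin 2
  tag (yes _) = fsuc fzero
  tag (no _)  = fzero
  tagged : Fin N → Fin (K * 2)
  tagged j = combine (f j) (tag (repeated? j))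
  distinctTags : ∀ {i j} → i Fin.< j → f i ≡ f j → tag (repeated? i) ≢ tag (repeated? j)
  distinctTags {i} {j} i<j fi≡fj with repeated? i | repeated? j
  ... | _                     | no none = λ _ → none (i , i<j , fi≡fj)
  ... | yes (h , h<i , fh≡fi) | yes _   = λ _ → noTriple h<i i<j fh≡fi fi≡fj
  ... | no _                  | yes _   = λ ()

shortestPath-order≤2*colours : ∀ {K c} p → IsGpColouring G K c → IsShortestPath G k p → suc k ≤ K * 2
shortestPath-order≤2*colours {c = c} p gp sp = fibresAtMostTwo⇒≤ (c ∘ p) λ {i} i<j j<l ci≡cj cj≡cl →
  gp (c (p i)) _ p sp i _ _ i<j j<l (refl , ≡.sym ci≡cj , ≡.sym (trans ci≡cj cj≡cl))

cliqueCover⇒gpColouring : ∀ {b c} → IsCliqueCover G b c → IsGpColouring G b c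
cliqueCover⇒gpColouring {G = G} cover x = clique⇒generalPosition {G = G} (cover x)

χgp≤θ : ∀ {a b} → IsChiGp G a → IsTheta G b → a ≤ b
χgp≤θ {G = G} (_ , minimal) ((c , cover) , _) = minimal _ c (cliqueCover⇒gpColouring {G = G} cover)

generalPosition-all⇒diameter≤1 : ∀ {S} p → (∀ v → S v) → GeneralPosition G S →
  IsShortestPath G k p → k ≤ 1
generalPosition-all⇒diameter≤1 {k = zero}        _ _   _  _  = z≤n
generalPosition-all⇒diameter≤1 {k = suc zero}    _ _   _  _  = s≤s z≤n
generalPosition-all⇒diameter≤1 {k = suc (suc k)} p all gp sp = ⊥-elim
  (gp _ p sp fzero (fsuc fzero) (fromℕ _) (s≤s z≤n) (s≤s (s≤s z≤n)) (all _ , all _ , all _))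

-- Constructively we only get ¬¬: a walk of length ≥ 2 that is not shortest has a shorter one.
generalPosition-all⇒¬¬adjacent : ∀ {S} → (∀ v → S v) → GeneralPosition G S →
  Walk G u v k → u ≢ v → ¬ ¬ Adj G u v
generalPosition-all⇒¬¬adjacent {G = G} {u = u} {v = v} {k = k} all gp p u≢v ¬adj =
  <-rec (λ k → ¬ Walk G u v k) noWalk k p
  where
  noWalk : ∀ k → (∀ {m} → m < k → ¬ Walk G u v m) → ¬ Walk G u v k
  noWalk k shorter q = [ u≢v , ¬adj ]
    (walk-≤1 q (generalPosition-all⇒diameter≤1 {G = G} (vertices q) all gp (minimal⇒shortestPath q minimal)))
    where
    minimal : ∀ {m} → Walk G u v m → k ≤ m
    minimal {m} r = decidable-stable (k ≤? m) λ k≰m → shorter (≰⇒> k≰m) r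

¬¬-∀-Fin : ∀ {P : Fin n → Set} → (∀ i → ¬ ¬ P i) → ¬ ¬ (∀ i → P i)
¬¬-∀-Fin {zero}  _  ¬all = ¬all λ ()
¬¬-∀-Fin {suc n} ¬¬P ¬all = ¬¬P fzero λ P₀ → ¬¬-∀-Fin (¬¬P ∘ fsuc) λ Pₛ →
  ¬all λ { fzero → P₀ ; (fsuc i) → Pₛ i }

connected-oneColour⇒θ≤1 : ∀ {c b} → Connected G → IsGpColouring G 1 c → IsTheta G b → b ≤ 1
connected-oneColour⇒θ≤1 {G = G} {c = c} {b = b} conn gp (_ , minimal) =
  decidable-stable (b ≤? 1) λ b≰1 →
    complete λ adj → b≰1 (minimal 1 (λ _ → fzero) λ _ u v _ _ → adj u v)
  where
  oneClass : ∀ v → c v ≡ fzero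
  oneClass v with c v
  ... | fzero = refl
  adjacent : ∀ u v → ¬ ¬ (u ≢ v → Adj G u v)
  adjacent u v with u Fin.≟ v
  ... | yes u≡v = λ ¬adj → ¬adj λ u≢v → ⊥-elim (u≢v u≡v)
  ... | no u≢v  = ¬¬-map (λ a _ → a)
        (generalPosition-all⇒¬¬adjacent {G = G} oneClass (gp fzero) (proj₂ (connected⇒walk conn u v)) u≢v)
  complete : ¬ ¬ (∀ u v → u ≢ v → Adj G u v)
  complete = ¬¬-∀-Fin λ u → ¬¬-∀-Fin (adjacent u)

realisable⇒ : ∀ {a b} → 1 ≤ a → 1 ≤ b → Connected G → IsChiGp G a → IsTheta G b →
  (a ≡ 1 × b ≡ 1) ⊎ (2 ≤ a × a ≤ b)
realisable⇒ {G = G} {a = suc zero} _ 1≤b conn ((c , gp) , _) θ =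
  inj₁ (refl , ≤-antisym (connected-oneColour⇒θ≤1 {G = G} {c = c} conn gp θ) 1≤b)
realisable⇒ {G = G} {a = suc (suc _)} _ _ _ χ θ = inj₂ (s≤s (s≤s z≤n) , χgp≤θ {G = G} χ θ)

independent⇒≤θ : ∀ {s c} (f : Fin s → Fin n) →
  (∀ {i j} → i Fin.< j → f i ≢ f j × ¬ Adj G (f i) (f j)) → IsCliqueCover G k c → s ≤ k
independent⇒≤θ {k = k} {s = s} {c = c} f independent cover = decidable-stable (s ≤? k) λ s≰k →
  let i , j , i<j , same = Fin.pigeonhole (≰⇒> s≰k) (c ∘ f)
      fi≢fj , ¬adj = independent i<j
  in  ¬adj (cover (c (f i)) (f i) (f j) refl (≡.sym same) fi≢fj)

fromℕ<≡⇒≡toℕ : ∀ {t K} .{t<K : t < K} {x : Fin K} → fromℕ< t<K ≡ x → t ≡ toℕ x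
fromℕ<≡⇒≡toℕ {t<K = t<K} refl = ≡.sym (Fin.toℕ-fromℕ< t<K)

⌊x/2⌋≡⌊y/2⌋⇒x<y⇒1+x≡y : ∀ {x y} → ⌊ x /2⌋ ≡ ⌊ y /2⌋ → x < y → suc x ≡ y
⌊x/2⌋≡⌊y/2⌋⇒x<y⇒1+x≡y {0}           {1}           _  _ = refl
⌊x/2⌋≡⌊y/2⌋⇒x<y⇒1+x≡y {0}           {suc (suc _)} () _
⌊x/2⌋≡⌊y/2⌋⇒x<y⇒1+x≡y {1}           {suc (suc _)} () _
⌊x/2⌋≡⌊y/2⌋⇒x<y⇒1+x≡y {suc (suc x)} {suc (suc y)} eq (s≤s (s≤s x<y)) =
  cong (suc ∘ suc) (⌊x/2⌋≡⌊y/2⌋⇒x<y⇒1+x≡y (suc-injective eq) x<y)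
⌊x/2⌋≡⌊y/2⌋⇒x<y⇒1+x≡y {1}           {1}           _  (s≤s ())
⌊x/2⌋≡⌊y/2⌋⇒x<y⇒1+x≡y {suc (suc _)} {1}           _  (s≤s ())

⌈n+n/2⌉≡n : ∀ n → ⌈ n + n /2⌉ ≡ n
⌈n+n/2⌉≡n n = +-cancelˡ-≡ n _ _
  (trans (cong (_+ ⌈ n + n /2⌉) (n≡⌊n+n/2⌋ n)) (⌊n/2⌋+⌈n/2⌉≡n (n + n)))

odd≢even : ∀ x y → suc (x + x) ≢ y + y
odd≢even x y eq = 1+n≢n (trans eq (cong (λ z → z + z) (≡.sym x≡y)))
  where
  x≡y : x ≡ y
  x≡y = trans (≡.sym (⌈n+n/2⌉≡n x)) (trans (cong ⌊_/2⌋ eq) (≡.sym (n≡⌊n+n/2⌋ y)))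

1+n+n≤m*2⇒n<m : ∀ {n m} → suc (n + n) ≤ m * 2 → n < m
1+n+n≤m*2⇒n<m {n} {m} le = ≰⇒> λ m≤n → 1+n≰n (≤-trans le (begin
  m * 2          ≤⟨ *-monoˡ-≤ 2 m≤n ⟩
  n * 2          ≡⟨ *-comm n 2 ⟩
  n + (n + 0)    ≡⟨ cong (n +_) (+-identityʳ n) ⟩
  n + n          ∎))
  where open ≤-Reasoning

-- The path 0 - 1 - ⋯ - L on m = L + 1 = 2a − 1 vertices, with leaves m, …, m + e − 1 attached to 1.
module PendantPath (p e : ℕ) where

  a L m : ℕ
  a = suc (suc p)
  L = suc p + suc p
  m = suc L

  data Edge : ℕ → ℕ → Set where
    step    : ∀ {t} → suc t < m → Edge t (suc t)
    pendant : ∀ {t} → m ≤ t → Edge 1 t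

  Adjacent : ℕ → ℕ → Set
  Adjacent s t = Edge s t ⊎ Edge t s

  edge-irrefl : ∀ {t} → ¬ Edge t t
  edge-irrefl (pendant (s≤s ()))

  graph : Graph (m + e)
  graph = record
    { Adj    = λ u v → Adjacent (toℕ u) (toℕ v)
    ; sym    = swap
    ; irrefl = [ edge-irrefl , edge-irrefl ]
    }

  1<m : 1 < m
  1<m = s≤s (s≤s z≤n)

  path<n : ∀ {t} → t < m → t < m + e
  path<n t<m = <-≤-trans t<m (m≤m+n m e)

  ¬edge-from-leaf : ∀ {s t} → m ≤ s → ¬ Edge s t
  ¬edge-from-leaf m≤s (step s+1<m) = <⇒≱ (<-trans (n<1+n _) s+1<m) m≤s
  ¬edge-from-leaf m≤1 (pendant _)  = <⇒≱ 1<m m≤1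

  edge-to-leaf : ∀ {s t} → m ≤ t → Edge s t → s ≡ 1
  edge-to-leaf m≤t (step t<m) = ⊥-elim (<⇒≱ t<m m≤t)
  edge-to-leaf _   (pendant _) = refl

  ¬edge-evens : ∀ {s t} x y → Edge s t → s ≡ x + x → t ≡ y + y → ⊥
  ¬edge-evens x y (step _)    refl t≡y+y = odd≢even x y t≡y+y
  ¬edge-evens x y (pendant _) 1≡x+x _    = odd≢even 0 x 1≡x+x

  consecutive : ∀ {s t} → suc s ≡ t → t < m → Adjacent s t
  consecutive refl t<m = inj₁ (step t<m)

  adjacent : ∀ {s t} (s<n : s < m + e) (t<n : t < m + e) →
    Adjacent s t → Adj graph (fromℕ< s<n) (fromℕ< t<n)
  adjacent s<n t<n = subst₂ Adjacent (≡.sym (Fin.toℕ-fromℕ< s<n)) (≡.sym (Fin.toℕ-fromℕ< t<n))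

  ordered⇒adjacent : ∀ {P : ℕ → Set} → (∀ {s t} → P s → P t → s < t → Adjacent s t) →
    ∀ u v → P (toℕ u) → P (toℕ v) → u ≢ v → Adj graph u v
  ordered⇒adjacent adj u v Pu Pv u≢v with <-cmp (toℕ u) (toℕ v)
  ... | tri< u<v _ _ = adj Pu Pv u<v
  ... | tri≈ _ u≡v _ = ⊥-elim (u≢v (Fin.toℕ-injective u≡v))
  ... | tri> _ _ v<u = swap (adj Pv Pu v<u)

  root : Fin (m + e)
  root = fromℕ< (path<n {0} (s≤s z≤n))

  path : ∀ t → (t<m : t < m) → Walk graph root (fromℕ< (path<n t<m)) t
  path zero    _     = []
  path (suc t) t+1<m = path t t<m ∷ʳ adjacent (path<n t<m) (path<n t+1<m) (inj₁ (step t+1<m))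
    where
    t<m : t < m
    t<m = <-trans (n<1+n t) t+1<m

  reach : ∀ v → ∃ (Walk graph root v)
  reach v with toℕ v <? m
  ... | yes v<m = toℕ v , subst (λ x → Walk graph root x (toℕ v)) (Fin.fromℕ<-toℕ v _) (path (toℕ v) v<m)
  ... | no  v≮m = 2 , adjacent (path<n (s≤s z≤n)) (path<n 1<m) (inj₁ (step 1<m))
                    ∷ subst (Adj graph _) (Fin.fromℕ<-toℕ v _)
                        (adjacent (path<n 1<m) (Fin.toℕ<n v) (inj₁ (pendant (≮⇒≥ v≮m))))
                    ∷ []

  connected : Connected graph
  connected = reachable⇒connected root reach

  ⌊t/2⌋<a : ∀ {t} → t < m → ⌊ t /2⌋ < a
  ⌊t/2⌋<a t<m = s≤s (≤-trans (⌊n/2⌋-mono (≤-pred t<m)) (≤-reflexive (≡.sym (n≡⌊n+n/2⌋ (suc p)))))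

  ⌈t/2⌉<a : ∀ {t} → t < m → ⌈ t /2⌉ < a
  ⌈t/2⌉<a t<m = s≤s (≤-trans (⌈n/2⌉-mono (≤-pred t<m)) (≤-reflexive (⌈n+n/2⌉≡n (suc p))))

  -- Colour classes {0, m, …, m + e − 1} and {2c − 1, 2c} for c = 1, …, p + 1.
  colourℕ : ℕ → ℕ
  colourℕ t with t <? m
  ... | yes _ = ⌈ t /2⌉
  ... | no  _ = 0

  colourℕ<a : ∀ t → colourℕ t < a
  colourℕ<a t with t <? m
  ... | yes t<m = ⌈t/2⌉<a t<m
  ... | no  _   = s≤s z≤n

  colourℕ≡0⇒neighbour≡1 : ∀ {t s} → colourℕ t ≡ 0 → Adjacent t s → s ≡ 1
  colourℕ≡0⇒neighbour≡1 {t} c≡0 adj with t <? m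
  colourℕ≡0⇒neighbour≡1 {zero} _ (inj₁ (step _))       | yes _   = refl
  colourℕ≡0⇒neighbour≡1 {zero} _ (inj₂ (pendant ()))   | yes _
  colourℕ≡0⇒neighbour≡1 {suc _} () _                   | yes _
  colourℕ≡0⇒neighbour≡1 _ (inj₁ st)                    | no  t≮m = ⊥-elim (¬edge-from-leaf (≮⇒≥ t≮m) st)
  colourℕ≡0⇒neighbour≡1 _ (inj₂ st)                    | no  t≮m = edge-to-leaf (≮⇒≥ t≮m) st

  colourℕ≡1+c⇒adjacent : ∀ {c s t} → colourℕ s ≡ suc c → colourℕ t ≡ suc c → s < t → Adjacent s t
  colourℕ≡1+c⇒adjacent {s = s} {t} cs ct s<t with s <? m | t <? m
  ... | yes _ | yes t<m = consecutive (suc-injective (⌊x/2⌋≡⌊y/2⌋⇒x<y⇒1+x≡y (trans cs (≡.sym ct)) (s≤s s<t))) t<m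
  ... | no _  | _       = ⊥-elim (0≢1+n cs)
  ... | yes _ | no _    = ⊥-elim (0≢1+n ct)

  colour : Fin (m + e) → Fin a
  colour v = fromℕ< (colourℕ<a (toℕ v))

  colour-class : ∀ {v x} → colour v ≡ x → colourℕ (toℕ v) ≡ toℕ x
  colour-class {v} = fromℕ<≡⇒≡toℕ {t<K = colourℕ<a (toℕ v)}

  colour-gp : IsGpColouring graph a colour
  colour-gp fzero = degreeAtMostOne⇒generalPosition {G = graph} λ cv≡0 vx vy →
    Fin.toℕ-injective (trans (neighbour≡1 cv≡0 vx) (≡.sym (neighbour≡1 cv≡0 vy)))
    where
    neighbour≡1 : ∀ {v x} → colour v ≡ fzero → Adj graph v x → toℕ x ≡ 1
    neighbour≡1 {v} cv≡0 = colourℕ≡0⇒neighbour≡1 (colour-class {v} cv≡0)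
  colour-gp (fsuc c) = clique⇒generalPosition {G = graph} λ u v cu cv →
    ordered⇒adjacent (colourℕ≡1+c⇒adjacent {c = toℕ c}) u v (colour-class {u} cu) (colour-class {v} cv)

  depth : ℕ → ℕ
  depth t with t <? m
  ... | yes _ = t
  ... | no  _ = 1

  depth-path : ∀ {t} → t < m → depth t ≡ t
  depth-path {t} t<m with t <? m
  ... | yes _   = refl
  ... | no  t≮m = ⊥-elim (t≮m t<m)

  depth-leaf : ∀ {t} → m ≤ t → depth t ≡ 1
  depth-leaf {t} m≤t with t <? m
  ... | yes t<m = ⊥-elim (<⇒≱ t<m m≤t)
  ... | no  _   = refl

  depth-adjacent : ∀ {s t} → Adjacent s t → depth t ≤ suc (depth s)
  depth-adjacent {s} (inj₁ (step t<m)) = ≤-reflexive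
    (trans (depth-path t<m) (cong suc (≡.sym (depth-path (<-trans (n<1+n s) t<m)))))
  depth-adjacent (inj₁ (pendant m≤t)) = ≤-trans (≤-reflexive (depth-leaf m≤t)) (s≤s z≤n)
  depth-adjacent {t = t} (inj₂ (step s<m)) = ≤-trans (≤-reflexive (depth-path (<-trans (n<1+n t) s<m)))
    (≤-trans (m≤n⇒m≤1+n (n≤1+n t)) (s≤s (≤-reflexive (≡.sym (depth-path s<m)))))
  depth-adjacent (inj₂ (pendant _)) = ≤-trans (≤-reflexive (depth-path 1<m)) (s≤s z≤n)

  longPath : Walk graph root (fromℕ< (path<n (n<1+n L))) L
  longPath = path L (n<1+n L)

  longPath-minimal : ∀ {k} → Walk graph root (fromℕ< (path<n (n<1+n L))) k → L ≤ k
  longPath-minimal {k} q = begin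
    L                                          ≡⟨ depth-path (n<1+n L) ⟨
    depth L                                    ≡⟨ cong depth (Fin.toℕ-fromℕ< (path<n (n<1+n L))) ⟨
    depth (toℕ (fromℕ< (path<n (n<1+n L))))    ≤⟨ walk-potential (depth ∘ toℕ) depth-adjacent q ⟩
    k + depth 0                                ≡⟨ cong (k +_) (depth-path (s≤s z≤n)) ⟩
    k + 0                                      ≡⟨ +-identityʳ k ⟩
    k                                          ∎
    where open ≤-Reasoning

  χgp : IsChiGp graph a
  χgp = (colour , colour-gp) , λ _ c gp → 1+n+n≤m*2⇒n<m
    (shortestPath-order≤2*colours {G = graph} {c = c} (vertices longPath) gp
      (minimal⇒shortestPath longPath longPath-minimal))

  -- Clique classes {0, 1}, {2, 3}, …, {L} on the path and one singleton per leaf.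
  coverℕ : ℕ → ℕ
  coverℕ t with t <? m
  ... | yes _ = ⌊ t /2⌋
  ... | no  _ = a + (t ∸ m)

  coverℕ< : ∀ {t} → t < m + e → coverℕ t < a + e
  coverℕ< {t} t<n with t <? m
  ... | yes t<m = <-≤-trans (⌊t/2⌋<a t<m) (m≤m+n a e)
  ... | no  t≮m = +-monoʳ-< a (subst (t ∸ m <_) (m+n∸m≡n m e) (∸-monoˡ-< t<n (≮⇒≥ t≮m)))

  coverℕ≡⇒adjacent : ∀ {c s t} → coverℕ s ≡ c → coverℕ t ≡ c → s < t → Adjacent s t
  coverℕ≡⇒adjacent {s = s} {t} cs ct s<t with s <? m | t <? m
  ... | yes _   | yes t<m = consecutive (⌊x/2⌋≡⌊y/2⌋⇒x<y⇒1+x≡y (trans cs (≡.sym ct)) s<t) t<m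
  ... | yes s<m | no  _   = ⊥-elim (<⇒≱ (⌊t/2⌋<a s<m) (≤-trans (m≤m+n a _) (≤-reflexive (trans ct (≡.sym cs)))))
  ... | no  _   | yes t<m = ⊥-elim (<⇒≱ (⌊t/2⌋<a t<m) (≤-trans (m≤m+n a _) (≤-reflexive (trans cs (≡.sym ct)))))
  ... | no  s≮m | no  t≮m = ⊥-elim (<⇒≢ s<t
        (∸-cancelʳ-≡ (≮⇒≥ s≮m) (≮⇒≥ t≮m) (+-cancelˡ-≡ a _ _ (trans cs (≡.sym ct)))))

  cover : Fin (m + e) → Fin (a + e)
  cover v = fromℕ< (coverℕ< (Fin.toℕ<n v))

  cover-class : ∀ {v x} → cover v ≡ x → coverℕ (toℕ v) ≡ toℕ x
  cover-class {v} = fromℕ<≡⇒≡toℕ {t<K = coverℕ< (Fin.toℕ<n v)}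

  cover-cliques : IsCliqueCover graph (a + e) cover
  cover-cliques x u v cu cv =
    ordered⇒adjacent (coverℕ≡⇒adjacent {c = toℕ x}) u v (cover-class {u} cu) (cover-class {v} cv)

  -- The independent set {0, 2, …, L} ∪ leaves, enumerated by stableℕ.
  stableℕ : ℕ → ℕ
  stableℕ i with i <? a
  ... | yes _ = i + i
  ... | no  _ = m + (i ∸ a)

  even<m : ∀ {i} → i < a → i + i < m
  even<m i<a = s≤s (+-mono-≤ (≤-pred i<a) (≤-pred i<a))

  stableℕ< : ∀ {i} → i < a + e → stableℕ i < m + e
  stableℕ< {i} i<a+e with i <? a
  ... | yes i<a = path<n (even<m i<a)
  ... | no  i≮a = +-monoʳ-< m (subst (i ∸ a <_) (m+n∸m≡n a e) (∸-monoˡ-< i<a+e (≮⇒≥ i≮a)))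

  ¬adjacent-evens : ∀ x y → ¬ Adjacent (x + x) (y + y)
  ¬adjacent-evens x y (inj₁ st) = ¬edge-evens x y st refl refl
  ¬adjacent-evens x y (inj₂ ts) = ¬edge-evens y x ts refl refl

  ¬adjacent-even-leaf : ∀ x {t} → m ≤ t → ¬ Adjacent (x + x) t
  ¬adjacent-even-leaf x m≤t (inj₁ st) = odd≢even 0 x (≡.sym (edge-to-leaf m≤t st))
  ¬adjacent-even-leaf x m≤t (inj₂ ts) = ¬edge-from-leaf m≤t ts

  ¬adjacent-leaves : ∀ {s t} → m ≤ s → m ≤ t → ¬ Adjacent s t
  ¬adjacent-leaves m≤s m≤t = [ ¬edge-from-leaf m≤s , ¬edge-from-leaf m≤t ]

  stableℕ-independent : ∀ {i j} → i < j → stableℕ i ≢ stableℕ j × ¬ Adjacent (stableℕ i) (stableℕ j)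
  stableℕ-independent {i} {j} i<j with i <? a | j <? a
  ... | yes _   | yes _   = (λ eq → <⇒≢ i<j (halve eq)) , ¬adjacent-evens i j
    where
    halve : i + i ≡ j + j → i ≡ j
    halve eq = trans (n≡⌊n+n/2⌋ i) (trans (cong ⌊_/2⌋ eq) (≡.sym (n≡⌊n+n/2⌋ j)))
  ... | yes i<a | no  _   = (λ eq → <⇒≱ (even<m i<a) (subst (m ≤_) (≡.sym eq) (m≤m+n m _)))
                          , ¬adjacent-even-leaf i (m≤m+n m _)
  ... | no  i≮a | yes j<a = ⊥-elim (i≮a (<-trans i<j j<a))
  ... | no  i≮a | no  j≮a = (λ eq → <⇒≢ i<j (∸-cancelʳ-≡ (≮⇒≥ i≮a) (≮⇒≥ j≮a) (+-cancelˡ-≡ m _ _ eq)))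
                          , ¬adjacent-leaves (m≤m+n m _) (m≤m+n m _)

  stable : Fin (a + e) → Fin (m + e)
  stable i = fromℕ< (stableℕ< (Fin.toℕ<n i))

  stable-independent : ∀ {i j} → i Fin.< j → stable i ≢ stable j × ¬ Adj graph (stable i) (stable j)
  stable-independent {i} {j} i<j with stableℕ-independent i<j
  ... | distinct , ¬adjacent =
        (λ eq → distinct (Fin.fromℕ<-injective _ _ (stableℕ< (Fin.toℕ<n i)) (stableℕ< (Fin.toℕ<n j)) eq))
      , ¬adjacent ∘ subst₂ Adjacent (Fin.toℕ-fromℕ< _) (Fin.toℕ-fromℕ< _)

  θ : IsTheta graph (a + e)
  θ = (cover , cover-cliques) , λ _ _ cover′ → independent⇒≤θ {G = graph} stable stable-independent cover′

K₁ : Graph 1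
K₁ = record { Adj = λ _ _ → ⊥ ; sym = λ () ; irrefl = λ () }

K₁-clique : ∀ {S} → IsClique K₁ S
K₁-clique fzero fzero _ _ 0≢0 = 0≢0 refl

K₁-colours : ∀ {k} (c : Fin 1 → Fin k) → 1 ≤ k
K₁-colours {zero}  c = ⊥-elim (Fin.¬Fin0 (c fzero))
K₁-colours {suc _} _ = s≤s z≤n

K₁-realises : Connected K₁ × IsChiGp K₁ 1 × IsTheta K₁ 1
K₁-realises = reachable⇒connected {G = K₁} fzero (λ { fzero → 0 , [] ; (fsuc ()) })
            , (((λ _ → fzero) , λ _ → clique⇒generalPosition {G = K₁} K₁-clique) , λ _ c _ → K₁-colours c)
            , (((λ _ → fzero) , λ _ → K₁-clique) , λ _ c _ → K₁-colours c)

realisable⇐ : ∀ {a b} → (a ≡ 1 × b ≡ 1) ⊎ (2 ≤ a × a ≤ b) →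
  Σ ℕ λ n → Σ (Graph n) λ G → Connected G × IsChiGp G a × IsTheta G b
realisable⇐ (inj₁ (refl , refl)) = 1 , K₁ , K₁-realises
realisable⇐ {suc (suc p)} (inj₂ (s≤s (s≤s z≤n) , a≤b)) with m≤n⇒∃[o]m+o≡n a≤b
... | e , refl = _ , graph , connected , χgp , θ
  where open PendantPath p e

mainTheorem10 : (a b : ℕ) → 1 ≤ a → 1 ≤ b →
    (Σ ℕ (λ n → Σ (Graph n) (λ G → Connected G × IsChiGp G a × IsTheta G b)))
      ⇔ ((a ≡ 1 × b ≡ 1) ⊎ (2 ≤ a × a ≤ b))
mainTheorem10 a b 1≤a 1≤b =
  mk⇔ (λ (_ , G , conn , χ , θ) → realisable⇒ {G = G} 1≤a 1≤b conn χ θ) realisable⇐
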